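{- Let $k\in\mathbb{R}_{\geq 0}$ and let $G$ be a graph on $n\geq 2$ vertices such that every subgraph $H\subseteq G$ on at least three vertices satisfies $|E(H)|\leq k(|V(H)|-2)$. If $G$ admits an interval colouring, then $t(G)\leq \frac{k}{2}n+1-k$.
   Context: All graphs are finite and simple. An interval colouring of a graph $G$ is a proper edge-colouring $c\colon E(G)\to\mathbb{N}$ such that for every vertex $v$, the set $\{c(vw)\colon w\in N(v)\}$ consists of consecutive integers. For an interval colourable graph $G$, $t(G)$ denotes the greatest number of distinct colours used in an interval colouring of $G$.
   Formalization: The parameter k ranges over the non-negative rationals instead of $\mathbb{R}_{\geq 0}$. -}

module Defs where

open import Data.Bool using (Bool; true; false; T; _∧_)
open import Data.Bool.Properties using (T?)
open import Data.Nat using (ℕ; _≤_; _<ᵇ_)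
import Data.Nat as ℕ
open import Data.Fin using (Fin; toℕ)
open import Data.Fin.Subset using (Subset; _∈_)
open import Data.List using (List; length; filter; map; concatMap; allFin; deduplicate)
open import Data.Product using (Σ; ∃; _×_; _,_)
open import Data.Integer using (+_)
open import Data.Rational using (ℚ; _/_)
open import Relation.Binary.PropositionalEquality using (_≡_; _≢_)

record Graph (n : ℕ) : Set where
  field
    adj   : Fin n → Fin n → Bool
    sym   : ∀ i j → adj i j ≡ adj j i
    irrefl : ∀ i → adj i i ≡ false
open Graph public

-- Each edge {i,j} is listed once, as the ordered pair (i , j) with i < j.
isEdge : ∀ {n} → Graph n → Fin n → Fin n → Bool
isEdge G i j = (toℕ i <ᵇ toℕ j) ∧ adj G i j

edges : ∀ {n} → Graph n → List (Fin n × Fin n)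
edges {n} G =
  concatMap (λ i → map (λ j → (i , j)) (filter (λ j → T? (isEdge G i j)) (allFin n))) (allFin n)

numEdges : ∀ {n} → Graph n → ℕ
numEdges G = length (edges G)

-- H ⊆ G is a subgraph with vertex set S (a subset of V(G) = Fin n):
-- every edge of H is an edge of G, and has both endpoints in S.
-- (H is represented as a graph on Fin n whose edges lie inside S.)
IsSubgraph : ∀ {n} → Graph n → Subset n → Graph n → Set
IsSubgraph {n} H S G =
  (∀ (i j : Fin n) → adj H i j ≡ true → adj G i j ≡ true × i ∈ S × j ∈ S)

-- c is a colouring of the edges: c v w is the colour of the edge vw
-- (values on non-edges are irrelevant).
-- colour x appears at vertex v
ColourAt : ∀ {n} → Graph n → (Fin n → Fin n → ℕ) → Fin n → ℕ → Set
ColourAt G c v x = ∃ λ w → adj G v w ≡ true × c v w ≡ x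

record IsIntervalColouring {n} (G : Graph n) (c : Fin n → Fin n → ℕ) : Set where
  field
    symmetric : ∀ v w → adj G v w ≡ true → c v w ≡ c w v
    proper    : ∀ v w u → adj G v w ≡ true → adj G v u ≡ true → w ≢ u → c v w ≢ c v u
    interval  : ∀ v a b d → a ≤ b → b ≤ d →
                ColourAt G c v a → ColourAt G c v d → ColourAt G c v b

numColours : ∀ {n} → Graph n → (Fin n → Fin n → ℕ) → ℕ
numColours G c =
  length (deduplicate ℕ._≟_ (map (λ e → c (Data.Product.proj₁ e) (Data.Product.proj₂ e)) (edges G)))

ℕtoℚ : ℕ → ℚ
ℕtoℚ m = (+ m) / 1

{-# OPTIONS --safe #-}
module Submission where

-- For a threshold x let U x be the number of colours below x in use, E x the number of edges
-- with a colour below x, and N x the number of vertices on such an edge (prefixSupport,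
-- prefixSum and touched below). By strong induction on x we show 2 (U x − 1) ≤ k (N x − 2);
-- for x above every colour this is t ≤ k (n − 2) / 2 + 1.
-- Call a colour a singleton if exactly one edge has it, and let p be a colour in use.
-- If there is no singleton below p, every colour in use below p has at least two edges, so
-- 2 U p ≤ E (p + 1), and the hypothesis applied to the edges of colour ≤ p gives the claim.
-- Otherwise let q < p be the last singleton, on the edge xy, and H the subgraph of the edges
-- with colour in [q, p]. No colour strictly between q and p is a singleton, so
-- 2 (U p − U q) ≤ |E(H)|. A vertex of H that also has a colour ≤ q has colour q by the
-- interval property, so it is x or y; hence |V(H)| ≤ N (p + 1) − N (q + 1) + 2, and the
-- hypothesis for H added to the induction hypothesis at q + 1 gives the claim at p + 1.

open import Defs renaming (sym to adj-swap; irrefl to adj-irrefl)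
open import Data.Bool using (true; false; _∧_)
import Data.Bool as Bool using (_≟_)
open import Data.Bool.Properties using (T?; T-≡; T-∧; ∧-conicalʳ)
open import Data.Empty using (⊥-elim)
open import Data.Fin using (Fin; toℕ) renaming (_≟_ to _≟ᶠ_)
open import Data.Fin.Properties using (toℕ-injective; any?)
open import Data.Fin.Subset using (Subset; _∈_; _⊆_; _∪_; _∩_; ⁅_⁆; ∣_∣; inside; outside)
open import Data.Fin.Subset.Properties
  using (x∈p⇒∣p-x∣<∣p∣; x∈p∧x≢y⇒x∈p-y; x∈p∩q⁻; x∈p∪q⁺; x∈p∪q⁻; x∈⁅x⁆; ∣⁅x⁆∣≡1; p⊆q⇒∣p∣≤∣q∣; ∣p∣≤n)
import Data.Integer as ℤ using (+_; _+_; _*_; _≤_; +≤+)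
import Data.Integer.Properties as ℤ using (pos-*; *-identityʳ)
open import Data.List using (List; []; _∷_; _++_; length; filter; map; concatMap; allFin; deduplicate)
open import Data.List.Extrema.Nat using (max; xs≤max)
open import Data.List.Membership.Propositional using (lose) renaming (_∈_ to _∈ₗ_)
open import Data.List.Membership.Propositional.Properties
  using (∈-filter⁻; ∈-map⁻; ∈-map⁺; ∈-deduplicate⁻; ∈-concatMap⁺; ∈-concatMap⁻; ∈-map∘filter⁺; ∈-map∘filter⁻; ∈-allFin)
open import Data.List.Properties using (filter-all; filter-++; filter-≐)
import Data.List.Relation.Unary.All as All
open import Data.List.Relation.Unary.AllPairs using (_∷_)
open import Data.List.Relation.Unary.Any using (here; there; satisfied)
open import Data.List.Relation.Unary.Unique.Propositional using (Unique)
import Data.List.Relation.Unary.Unique.Propositional.Properties as Unique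
open import Data.Nat
  using (ℕ; zero; suc; _+_; _*_; _∸_; _⊓_; _≤_; _<_; _≤′_; z≤n; s≤s; s≤s⁻¹; _≟_; _<?_; _<ᵇ_; ≤′-refl; ≤′-step)
open import Data.Nat.Coprimality using (1-coprimeTo) renaming (sym to coprime-sym)
open import Data.Nat.Induction using (<-rec)
open import Data.Nat.Properties
open import Data.Nat.Solver using (module +-*-Solver)
open import Data.List.Relation.Unary.Unique.DecPropositional.Properties _≟_ using (deduplicate-!)
open import Data.Product using (∃; _×_; _,_; proj₁; proj₂)
open import Data.Rational as ℚ using (ℚ; mkℚ; 0ℚ; 1ℚ; ½; _/_; *≤*) renaming (_≤_ to _≤ℚ_)
import Data.Rational.Properties as ℚ
import Data.Rational.Solver as ℚ-Solver
open import Data.Sum as Sum using (_⊎_; inj₁; inj₂; [_,_])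
open import Data.Vec using ([]; _∷_; tabulate)
open import Data.Vec.Properties using (lookup∘tabulate; lookup⇒[]=; []=⇒lookup)
open import Function using (_∘_)
open import Function.Bundles using (Equivalence)
open import Level using (Level)
open import Relation.Binary using (DecidableEquality; tri<; tri≈; tri>)
open import Relation.Binary.PropositionalEquality hiding ([_])
open import Relation.Nullary using (¬_; yes; no; does; ¬?; _×-dec_)
open import Relation.Nullary.Decidable using (dec-true)
open import Relation.Unary using (Pred; Decidable)
open import Relation.Unary.Properties using (_∪?_)

private
  variable
    a ℓ ℓ′ : Level
    A : Set a
    n : ℕ

module _ {P : Pred A ℓ} {Q : Pred A ℓ′} (P? : Decidable P) (Q? : Decidable Q) where

  length-filter-∪ : (∀ {x} → P x → ¬ Q x) → ∀ xs →
                    length (filter P? xs) + length (filter Q? xs) ≡ length (filter (P? ∪? Q?) xs)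
  length-filter-∪ disj [] = refl
  length-filter-∪ disj (x ∷ xs) with P? x | Q? x
  ... | yes Px | yes Qx = ⊥-elim (disj Px Qx)
  ... | yes _  | no _   = cong suc (length-filter-∪ disj xs)
  ... | no _   | yes _  = trans (+-suc _ _) (cong suc (length-filter-∪ disj xs))
  ... | no _   | no _   = length-filter-∪ disj xs

module _ {A : Set a} (_≟ᴬ_ : DecidableEquality A) where

  length≤1+length-filter≢ : ∀ z {xs : List A} → Unique xs →
                            length xs ≤ suc (length (filter (λ y → ¬? (y ≟ᴬ z)) xs))
  length≤1+length-filter≢ z {[]} _ = z≤n
  length≤1+length-filter≢ z {x ∷ xs} (x∉xs ∷ u) with x ≟ᴬ z
  ... | yes refl = s≤s (≤-reflexive (sym (cong length (filter-all (λ y → ¬? (y ≟ᴬ x)) (All.map ≢-sym x∉xs)))))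
  ... | no _     = s≤s (length≤1+length-filter≢ z u)

lastBelow : ∀ {P : Pred ℕ ℓ} → Decidable P → ∀ r →
            (∀ {x} → x < r → ¬ P x) ⊎ ∃ λ q → q < r × P q × (∀ {x} → q < x → x < r → ¬ P x)
lastBelow P? zero = inj₁ λ ()
lastBelow P? (suc r) with P? r
... | yes Pr = inj₂ (r , ≤-refl , Pr , λ r<x x<1+r → ⊥-elim (<⇒≱ r<x (s≤s⁻¹ x<1+r)))
... | no ¬Pr with lastBelow P? r
...   | inj₁ none = inj₁ λ x<1+r → [ none , (λ { refl → ¬Pr }) ] (m<1+n⇒m<n∨m≡n x<1+r)
...   | inj₂ (q , q<r , Pq , none) =
        inj₂ (q , m≤n⇒m≤1+n q<r , Pq , λ q<x x<1+r → [ none q<x , (λ { refl → ¬Pr }) ] (m<1+n⇒m<n∨m≡n x<1+r))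

∸2+∸2≤∸2 : ∀ {a b d} → 2 ≤ a → 2 ≤ b → a + b ≤ d + 2 → (a ∸ 2) + (b ∸ 2) ≤ d ∸ 2
∸2+∸2≤∸2 {suc (suc a)} {suc (suc b)} {d} (s≤s (s≤s _)) (s≤s (s≤s _)) a+b≤d+2 =
  m+n≤o⇒m≤o∸n (a + b) (+-cancelʳ-≤ 2 (a + b + 2) d (begin
    a + b + 2 + 2               ≡⟨ solve 2 (λ a b → a :+ b :+ con 2 :+ con 2 := con 2 :+ a :+ (con 2 :+ b)) refl a b ⟩
    suc (suc a) + suc (suc b)   ≤⟨ a+b≤d+2 ⟩
    d + 2                       ∎))
  where
  open ≤-Reasoning
  open +-*-Solver using (solve; _:+_; _:=_; con)

module PrefixCounts (m : ℕ → ℕ) where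

  prefixSum : ℕ → ℕ
  prefixSum zero    = 0
  prefixSum (suc r) = prefixSum r + m r

  prefixSupport : ℕ → ℕ
  prefixSupport zero    = 0
  prefixSupport (suc r) = 1 ⊓ m r + prefixSupport r

  prefixSupport≤prefixSum : ∀ r → prefixSupport r ≤ prefixSum r
  prefixSupport≤prefixSum zero    = z≤n
  prefixSupport≤prefixSum (suc r) = begin
    1 ⊓ m r + prefixSupport r ≤⟨ +-mono-≤ (m⊓n≤n 1 (m r)) (prefixSupport≤prefixSum r) ⟩
    m r + prefixSum r         ≡⟨ +-comm (m r) (prefixSum r) ⟩
    prefixSum r + m r         ∎
    where open ≤-Reasoning

  prefixSupport-suc : ∀ r → 0 < m r → prefixSupport (suc r) ≡ suc (prefixSupport r)
  prefixSupport-suc r 0<mr with m r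
  ... | suc _ = refl

  private
    2*[1⊓k]≤k : ∀ k → k ≢ 1 → 2 * (1 ⊓ k) ≤ k
    2*[1⊓k]≤k zero          _   = z≤n
    2*[1⊓k]≤k (suc zero)    k≢1 = ⊥-elim (k≢1 refl)
    2*[1⊓k]≤k (suc (suc k)) _   = s≤s (s≤s z≤n)

  open +-*-Solver using (solve; _:+_; _:*_; _:=_; con)

  2*prefixSupport-block : ∀ {lo r} → lo ≤′ r → (∀ {x} → lo ≤ x → x < r → m x ≢ 1) →
                          2 * prefixSupport r + prefixSum lo ≤ 2 * prefixSupport lo + prefixSum r
  2*prefixSupport-block ≤′-refl _ = ≤-refl
  2*prefixSupport-block {lo} {suc r} (≤′-step lo≤′r) no1 = begin
    2 * (1 ⊓ m r + prefixSupport r) + prefixSum lo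
      ≡⟨ solve 3 (λ a s e → con 2 :* (a :+ s) :+ e := con 2 :* a :+ (con 2 :* s :+ e)) refl
               (1 ⊓ m r) (prefixSupport r) (prefixSum lo) ⟩
    2 * (1 ⊓ m r) + (2 * prefixSupport r + prefixSum lo)
      ≤⟨ +-mono-≤ (2*[1⊓k]≤k (m r) (no1 (≤′⇒≤ lo≤′r) ≤-refl))
                  (2*prefixSupport-block lo≤′r (λ lo≤x x<r → no1 lo≤x (m≤n⇒m≤1+n x<r))) ⟩
    m r + (2 * prefixSupport lo + prefixSum r)
      ≡⟨ solve 3 (λ a s e → a :+ (s :+ e) := s :+ (e :+ a)) refl (m r) (2 * prefixSupport lo) (prefixSum r) ⟩
    2 * prefixSupport lo + (prefixSum r + m r) ∎
    where open ≤-Reasoning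

  2*prefixSupport≤prefixSum : ∀ p → (∀ {x} → x < p → m x ≢ 1) → 2 * prefixSupport p ≤ prefixSum (suc p)
  2*prefixSupport≤prefixSum p no1 = begin
    2 * prefixSupport p       ≤⟨ m≤m+n _ _ ⟩
    2 * prefixSupport p + 0   ≤⟨ 2*prefixSupport-block (≤⇒≤′ z≤n) (λ _ → no1) ⟩
    prefixSum p               ≤⟨ m≤m+n _ _ ⟩
    prefixSum (suc p)         ∎
    where open ≤-Reasoning

  2*prefixSupport-window : ∀ {q p} → m q ≡ 1 → q < p → 0 < m p → (∀ {x} → q < x → x < p → m x ≢ 1) →
                           2 * prefixSupport p + prefixSum q ≤ 2 * prefixSupport q + prefixSum (suc p)
  2*prefixSupport-window {q} {p} mq≡1 q<p 0<mp no1 = +-cancelʳ-≤ 1 _ _ (begin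
    2 * prefixSupport p + prefixSum q + 1
      ≡⟨ +-assoc (2 * prefixSupport p) (prefixSum q) 1 ⟩
    2 * prefixSupport p + (prefixSum q + 1)
      ≡⟨ cong (λ k → 2 * prefixSupport p + (prefixSum q + k)) mq≡1 ⟨
    2 * prefixSupport p + prefixSum (suc q)
      ≤⟨ 2*prefixSupport-block (≤⇒≤′ q<p) no1 ⟩
    2 * prefixSupport (suc q) + prefixSum p
      ≡⟨ cong (λ s → 2 * s + prefixSum p) (prefixSupport-suc q (≤-reflexive (sym mq≡1))) ⟩
    2 * suc (prefixSupport q) + prefixSum p
      ≡⟨ solve 2 (λ s e → con 2 :* (con 1 :+ s) :+ e := con 2 :* s :+ (e :+ con 1) :+ con 1) refl
               (prefixSupport q) (prefixSum p) ⟩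
    2 * prefixSupport q + (prefixSum p + 1) + 1
      ≤⟨ +-monoˡ-≤ 1 (+-monoʳ-≤ (2 * prefixSupport q) (+-monoʳ-≤ (prefixSum p) 0<mp)) ⟩
    2 * prefixSupport q + prefixSum (suc p) + 1 ∎)
    where
    open ≤-Reasoning

  length≤prefixSupport : ∀ r {xs} → Unique xs → (∀ {y} → y ∈ₗ xs → y < r × 0 < m y) →
                         length xs ≤ prefixSupport r
  length≤prefixSupport zero    {[]}    _ _     = z≤n
  length≤prefixSupport zero    {y ∷ _} _ bound with () ← proj₁ (bound (here refl))
  length≤prefixSupport (suc r) {xs}    u bound = begin
    length xs                 ≤⟨ removal ⟩
    1 ⊓ m r + length xs⁻      ≤⟨ +-monoʳ-≤ (1 ⊓ m r) (length≤prefixSupport r (Unique.filter⁺ _ u) bound⁻) ⟩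
    1 ⊓ m r + prefixSupport r ∎
    where
    open ≤-Reasoning
    xs⁻ : List ℕ
    xs⁻ = filter (λ y → ¬? (y ≟ r)) xs
    bound⁻ : ∀ {y} → y ∈ₗ xs⁻ → y < r × 0 < m y
    bound⁻ y∈xs⁻ with y∈xs , y≢r ← ∈-filter⁻ (λ y → ¬? (y ≟ r)) y∈xs⁻ =
      ≤∧≢⇒< (s≤s⁻¹ (proj₁ (bound y∈xs))) y≢r , proj₂ (bound y∈xs)
    removal : length xs ≤ 1 ⊓ m r + length xs⁻
    removal with m r in mr≡
    ... | suc _ = length≤1+length-filter≢ _≟_ r u
    ... | zero  = ≤-reflexive (cong length (sym (filter-all (λ y → ¬? (y ≟ r)) (All.tabulate r∉xs))))
      where
      r∉xs : ∀ {y} → y ∈ₗ xs → y ≢ r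
      r∉xs y∈xs refl with () ← subst (0 <_) mr≡ (proj₂ (bound y∈xs))

module _ {P : Pred (Fin n) ℓ} (P? : Decidable P) where

  subsetOf : Subset n
  subsetOf = tabulate (does ∘ P?)

  ∈-subsetOf⁺ : ∀ {x} → P x → x ∈ subsetOf
  ∈-subsetOf⁺ {x} Px = lookup⇒[]= x subsetOf (trans (lookup∘tabulate (does ∘ P?) x) (dec-true (P? x) Px))

  ∈-subsetOf⁻ : ∀ {x} → x ∈ subsetOf → P x
  ∈-subsetOf⁻ {x} x∈ with P? x | trans (sym (lookup∘tabulate (does ∘ P?) x)) ([]=⇒lookup x∈)
  ... | yes Px | _ = Px

∣p∪q∣+∣p∩q∣≡∣p∣+∣q∣ : ∀ (p q : Subset n) → ∣ p ∪ q ∣ + ∣ p ∩ q ∣ ≡ ∣ p ∣ + ∣ q ∣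
∣p∪q∣+∣p∩q∣≡∣p∣+∣q∣ []            []            = refl
∣p∪q∣+∣p∩q∣≡∣p∣+∣q∣ (inside ∷ p)  (inside ∷ q)  =
  cong suc (trans (+-suc _ _) (trans (cong suc (∣p∪q∣+∣p∩q∣≡∣p∣+∣q∣ p q)) (sym (+-suc _ _))))
∣p∪q∣+∣p∩q∣≡∣p∣+∣q∣ (inside ∷ p)  (outside ∷ q) = cong suc (∣p∪q∣+∣p∩q∣≡∣p∣+∣q∣ p q)
∣p∪q∣+∣p∩q∣≡∣p∣+∣q∣ (outside ∷ p) (inside ∷ q)  = trans (cong suc (∣p∪q∣+∣p∩q∣≡∣p∣+∣q∣ p q)) (sym (+-suc _ _))
∣p∪q∣+∣p∩q∣≡∣p∣+∣q∣ (outside ∷ p) (outside ∷ q) = ∣p∪q∣+∣p∩q∣≡∣p∣+∣q∣ p q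

∣p∪q∣≤∣p∣+∣q∣ : ∀ (p q : Subset n) → ∣ p ∪ q ∣ ≤ ∣ p ∣ + ∣ q ∣
∣p∪q∣≤∣p∣+∣q∣ p q = ≤-trans (m≤m+n _ _) (≤-reflexive (∣p∪q∣+∣p∩q∣≡∣p∣+∣q∣ p q))

1≤∣p∣ : ∀ {p : Subset n} {x} → x ∈ p → 1 ≤ ∣ p ∣
1≤∣p∣ x∈p = ≤-trans (s≤s z≤n) (x∈p⇒∣p-x∣<∣p∣ x∈p)

2≤∣p∣ : ∀ {p : Subset n} {x y} → x ∈ p → y ∈ p → x ≢ y → 2 ≤ ∣ p ∣
2≤∣p∣ x∈p y∈p x≢y = ≤-trans (s≤s (1≤∣p∣ (x∈p∧x≢y⇒x∈p-y y∈p (≢-sym x≢y)))) (x∈p⇒∣p-x∣<∣p∣ x∈p)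

3≤∣p∣ : ∀ {p : Subset n} {x y z} → x ∈ p → y ∈ p → z ∈ p → x ≢ y → x ≢ z → y ≢ z → 3 ≤ ∣ p ∣
3≤∣p∣ x∈p y∈p z∈p x≢y x≢z y≢z =
  ≤-trans (s≤s (2≤∣p∣ (x∈p∧x≢y⇒x∈p-y y∈p (≢-sym x≢y)) (x∈p∧x≢y⇒x∈p-y z∈p (≢-sym x≢z)) y≢z))
          (x∈p⇒∣p-x∣<∣p∣ x∈p)

-- Bounds of the form a ≤ k·b

ℕtoℚ≡mkℚ : ∀ a → ℕtoℚ a ≡ mkℚ (ℤ.+ a) 0 (coprime-sym (1-coprimeTo a))
ℕtoℚ≡mkℚ a = ℚ.normalize-coprime (coprime-sym (1-coprimeTo a))

ℕtoℚ-homo-* : ∀ a b → ℕtoℚ (a * b) ≡ ℕtoℚ a ℚ.* ℕtoℚ b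
ℕtoℚ-homo-* a b rewrite ℕtoℚ≡mkℚ a | ℕtoℚ≡mkℚ b = cong (_/ 1) (ℤ.pos-* a b)

ℕtoℚ-homo-+ : ∀ a b → ℕtoℚ (a + b) ≡ ℕtoℚ a ℚ.+ ℕtoℚ b
ℕtoℚ-homo-+ a b rewrite ℕtoℚ≡mkℚ a | ℕtoℚ≡mkℚ b =
  cong₂ (λ x y → (x ℤ.+ y) / 1) (sym (ℤ.*-identityʳ (ℤ.+ a))) (sym (ℤ.*-identityʳ (ℤ.+ b)))

ℕtoℚ-mono-≤ : ∀ {a b} → a ≤ b → ℕtoℚ a ≤ℚ ℕtoℚ b
ℕtoℚ-mono-≤ {a} {b} a≤b rewrite ℕtoℚ≡mkℚ a | ℕtoℚ≡mkℚ b =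
  *≤* (subst₂ ℤ._≤_ (sym (ℤ.*-identityʳ (ℤ.+ a))) (sym (ℤ.*-identityʳ (ℤ.+ b))) (ℤ.+≤+ a≤b))

ℕtoℚ-homo-∸ : ∀ {a b} → b ≤ a → ℕtoℚ (a ∸ b) ≡ ℕtoℚ a ℚ.- ℕtoℚ b
ℕtoℚ-homo-∸ {a} {b} b≤a = begin
  ℕtoℚ (a ∸ b)                          ≡⟨ solve 2 (λ x y → x := (x :+ y) :- y) refl (ℕtoℚ (a ∸ b)) (ℕtoℚ b) ⟩
  (ℕtoℚ (a ∸ b) ℚ.+ ℕtoℚ b) ℚ.- ℕtoℚ b  ≡⟨ cong (ℚ._- ℕtoℚ b) (ℕtoℚ-homo-+ (a ∸ b) b) ⟨
  ℕtoℚ (a ∸ b + b) ℚ.- ℕtoℚ b           ≡⟨ cong (λ x → ℕtoℚ x ℚ.- ℕtoℚ b) (m∸n+n≡m b≤a) ⟩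
  ℕtoℚ a ℚ.- ℕtoℚ b                     ∎
  where
  open ≡-Reasoning
  open ℚ-Solver.+-*-Solver

-- A record rather than a synonym so that a, k and b can be inferred from the type.
record _≤[_]·_ (a : ℕ) (k : ℚ) (b : ℕ) : Set where
  constructor scaled
  field ≤-scaled : ℕtoℚ a ≤ℚ k ℚ.* ℕtoℚ b

infix 4 _≤[_]·_

≤[]·-∸ : ∀ {e a b k} → b ≤ a → ℕtoℚ e ≤ℚ k ℚ.* (ℕtoℚ a ℚ.- ℕtoℚ b) → e ≤[ k ]· a ∸ b
≤[]·-∸ {e} {k = k} b≤a e≤k[a-b] = scaled (subst (λ x → ℕtoℚ e ≤ℚ k ℚ.* x) (sym (ℕtoℚ-homo-∸ b≤a)) e≤k[a-b])

module _ {k : ℚ} (0≤k : 0ℚ ≤ℚ k) where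

  private
    k*-mono-≤ : ∀ {x y} → x ≤ℚ y → k ℚ.* x ≤ℚ k ℚ.* y
    k*-mono-≤ = ℚ.*-monoˡ-≤-nonNeg k {{ℚ.nonNegative 0≤k}}

  0≤[]· : ∀ {b} → 0 ≤[ k ]· b
  0≤[]· {b} = scaled (ℚ.≤-trans (ℚ.≤-reflexive (sym (ℚ.*-zeroʳ k))) (k*-mono-≤ (ℕtoℚ-mono-≤ {0} {b} z≤n)))

  ≤[]·-mono : ∀ {a a′ b b′} → a′ ≤ a → b ≤ b′ → a ≤[ k ]· b → a′ ≤[ k ]· b′
  ≤[]·-mono a′≤a b≤b′ (scaled a≤kb) =
    scaled (ℚ.≤-trans (ℕtoℚ-mono-≤ a′≤a) (ℚ.≤-trans a≤kb (k*-mono-≤ (ℕtoℚ-mono-≤ b≤b′))))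

  +-mono-≤[]· : ∀ {a b c d} → a ≤[ k ]· b → c ≤[ k ]· d → a + c ≤[ k ]· b + d
  +-mono-≤[]· {a} {b} {c} {d} (scaled a≤kb) (scaled c≤kd) = scaled (begin
    ℕtoℚ (a + c)                       ≡⟨ ℕtoℚ-homo-+ a c ⟩
    ℕtoℚ a ℚ.+ ℕtoℚ c                  ≤⟨ ℚ.+-mono-≤ a≤kb c≤kd ⟩
    k ℚ.* ℕtoℚ b ℚ.+ k ℚ.* ℕtoℚ d      ≡⟨ ℚ.*-distribˡ-+ k (ℕtoℚ b) (ℕtoℚ d) ⟨
    k ℚ.* (ℕtoℚ b ℚ.+ ℕtoℚ d)          ≡⟨ cong (k ℚ.*_) (ℕtoℚ-homo-+ b d) ⟨
    k ℚ.* ℕtoℚ (b + d)                 ∎)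
    where open ℚ.≤-Reasoning

  ≤½kn+1-k : ∀ {t n} → 2 ≤ n → 2 * (t ∸ 1) ≤[ k ]· n ∸ 2 → ℕtoℚ t ≤ℚ ((½ ℚ.* k) ℚ.* ℕtoℚ n ℚ.+ 1ℚ) ℚ.- k
  ≤½kn+1-k {t} {n} 2≤n (scaled bound) = begin
    ℕtoℚ t                                           ≤⟨ ℕtoℚ-mono-≤ (m≤n+m∸n t 1) ⟩
    ℕtoℚ (1 + (t ∸ 1))                               ≡⟨ ℕtoℚ-homo-+ 1 (t ∸ 1) ⟩
    1ℚ ℚ.+ ℕtoℚ (t ∸ 1)                              ≡⟨ solve 1 (λ x → con 1ℚ :+ x := con ½ :* (con (ℕtoℚ 2) :* x) :+ con 1ℚ)
                                                              refl (ℕtoℚ (t ∸ 1)) ⟩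
    ½ ℚ.* (ℕtoℚ 2 ℚ.* ℕtoℚ (t ∸ 1)) ℚ.+ 1ℚ           ≡⟨ cong (λ x → ½ ℚ.* x ℚ.+ 1ℚ) (ℕtoℚ-homo-* 2 (t ∸ 1)) ⟨
    ½ ℚ.* ℕtoℚ (2 * (t ∸ 1)) ℚ.+ 1ℚ                  ≤⟨ ℚ.+-monoˡ-≤ 1ℚ (ℚ.*-monoˡ-≤-nonNeg ½ bound) ⟩
    ½ ℚ.* (k ℚ.* ℕtoℚ (n ∸ 2)) ℚ.+ 1ℚ                ≡⟨ solve 2 (λ k x → con ½ :* (k :* x) :+ con 1ℚ :=
                                                                   ((con ½ :* k) :* (x :+ con (ℕtoℚ 2)) :+ con 1ℚ) :- k)
                                                              refl k (ℕtoℚ (n ∸ 2)) ⟩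
    ((½ ℚ.* k) ℚ.* (ℕtoℚ (n ∸ 2) ℚ.+ ℕtoℚ 2) ℚ.+ 1ℚ) ℚ.- k
      ≡⟨ cong (λ x → ((½ ℚ.* k) ℚ.* x ℚ.+ 1ℚ) ℚ.- k)
              (trans (sym (ℕtoℚ-homo-+ (n ∸ 2) 2)) (cong ℕtoℚ (m∸n+n≡m 2≤n))) ⟩
    ((½ ℚ.* k) ℚ.* ℕtoℚ n ℚ.+ 1ℚ) ℚ.- k              ∎
    where
    open ℚ.≤-Reasoning
    open ℚ-Solver.+-*-Solver

module _ {n} (G : Graph n) where

  private
    row : Graph n → Fin n → List (Fin n × Fin n)
    row K i = map (λ j → (i , j)) (filter (λ j → T? (isEdge K i j)) (allFin n))

  ∈-edges⁻ : ∀ {i j} → (i , j) ∈ₗ edges G → adj G i j ≡ true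
  ∈-edges⁻ ij∈ with satisfied (∈-concatMap⁻ (row G) {xs = allFin n} ij∈)
  ... | i , ij∈row with ∈-map∘filter⁻ (λ j → (i , j)) (λ j → T? (isEdge G i j)) {xs = allFin n} ij∈row
  ... | _ , _ , refl , isEdge-ij = ∧-conicalʳ _ _ (Equivalence.to T-≡ isEdge-ij)

  private
    ∈-edges-< : ∀ {i j} → adj G i j ≡ true → toℕ i < toℕ j → (i , j) ∈ₗ edges G
    ∈-edges-< {i} {j} ij-adj i<j = ∈-concatMap⁺ (row G) (lose (∈-allFin i)
      (∈-map∘filter⁺ (λ j → (i , j)) (λ j → T? (isEdge G i j))
        (j , ∈-allFin j , refl , Equivalence.from T-∧ (<⇒<ᵇ i<j , Equivalence.from T-≡ ij-adj))))

  adj-sym : ∀ {i j} → adj G i j ≡ true → adj G j i ≡ true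
  adj-sym {i} {j} ij-adj = trans (adj-swap G j i) ij-adj

  adj⇒≢ : ∀ {i j} → adj G i j ≡ true → i ≢ j
  adj⇒≢ {i} ii-adj refl with () ← trans (sym ii-adj) (adj-irrefl G i)

  ∈-edges⁺ : ∀ {i j} → adj G i j ≡ true → (i , j) ∈ₗ edges G ⊎ (j , i) ∈ₗ edges G
  ∈-edges⁺ {i} {j} ij-adj with <-cmp (toℕ i) (toℕ j)
  ... | tri< i<j _ _ = inj₁ (∈-edges-< ij-adj i<j)
  ... | tri≈ _ i≡j _ = ⊥-elim (adj⇒≢ ij-adj (toℕ-injective i≡j))
  ... | tri> _ _ j<i = inj₂ (∈-edges-< (adj-sym ij-adj) j<i)

  module _ {P : Pred (Fin n × Fin n) ℓ} (P? : Decidable P)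
           (P-sym : ∀ {i j} → adj G i j ≡ true → P (i , j) → P (j , i)) where

    private
      restrict-sym : ∀ i j → adj G i j ∧ does (P? (i , j)) ≡ adj G j i ∧ does (P? (j , i))
      restrict-sym i j with adj G i j in ij | adj G j i in ji
      ... | false | false = refl
      ... | true  | false with () ← trans (sym ij) (trans (adj-swap G i j) ji)
      ... | false | true  with () ← trans (sym ji) (trans (adj-swap G j i) ij)
      ... | true  | true  with P? (i , j) | P? (j , i)
      ...   | yes _   | yes _   = refl
      ...   | no _    | no _    = refl
      ...   | yes Pij | no ¬Pji = ⊥-elim (¬Pji (P-sym ij Pij))
      ...   | no ¬Pij | yes Pji = ⊥-elim (¬Pij (P-sym ji Pji))

    restrict : Graph n
    restrict = record
      { adj    = λ i j → adj G i j ∧ does (P? (i , j))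
      ; sym    = restrict-sym
      ; irrefl = λ i → cong (_∧ does (P? (i , i))) (adj-irrefl G i)
      }

    adj-restrict⁻ : ∀ {i j} → adj restrict i j ≡ true → adj G i j ≡ true × P (i , j)
    adj-restrict⁻ {i} {j} ij-adj with adj G i j | P? (i , j)
    ... | true | yes Pij = refl , Pij

    adj-restrict⁺ : ∀ {i j} → adj G i j ≡ true → P (i , j) → adj restrict i j ≡ true
    adj-restrict⁺ {i} {j} ij-adj Pij = cong₂ _∧_ ij-adj (dec-true (P? (i , j)) Pij)

    edges-restrict : edges restrict ≡ filter P? (edges G)
    edges-restrict = go (allFin n)
      where
      row-restrict : ∀ i js → map (λ j → (i , j)) (filter (λ j → T? (isEdge restrict i j)) js)
                            ≡ filter P? (map (λ j → (i , j)) (filter (λ j → T? (isEdge G i j)) js))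
      row-restrict i [] = refl
      row-restrict i (j ∷ js) with toℕ i <ᵇ toℕ j | adj G i j
      ... | false | _     = row-restrict i js
      ... | true  | false = row-restrict i js
      ... | true  | true  with P? (i , j)
      ...   | yes _ = cong ((i , j) ∷_) (row-restrict i js)
      ...   | no _  = row-restrict i js
      go : ∀ is → concatMap (row restrict) is ≡ filter P? (concatMap (row G) is)
      go []       = refl
      go (i ∷ is) = trans (cong₂ _++_ (row-restrict i (allFin n)) (go is))
                          (sym (filter-++ P? (row G i) (concatMap (row G) is)))

module _ {n} {H : Graph n} where

  numEdges-pos : 0 < numEdges H → ∃ λ i → ∃ λ j → adj H i j ≡ true
  numEdges-pos 0<e with edges H in eq
  ... | (i , j) ∷ _ = i , j , ∈-edges⁻ H (subst ((i , j) ∈ₗ_) (sym eq) (here refl))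

  adj⇒numEdges-pos : ∀ {i j} → adj H i j ≡ true → 0 < numEdges H
  adj⇒numEdges-pos ij-adj = [ nonempty , nonempty ] (∈-edges⁺ H ij-adj)
    where
    nonempty : ∀ {e} → e ∈ₗ edges H → 0 < numEdges H
    nonempty e∈ with edges H
    nonempty (here _)  | _ ∷ _ = s≤s z≤n
    nonempty (there _) | _ ∷ _ = s≤s z≤n

  numEdges≡1 : numEdges H ≡ 1 →
               ∃ λ x → ∃ λ y → adj H x y ≡ true × (∀ {i j} → adj H i j ≡ true → i ≡ x ⊎ i ≡ y)
  numEdges≡1 e≡1 with edges H in eq
  ... | (x , y) ∷ [] = x , y , ∈-edges⁻ H (subst ((x , y) ∈ₗ_) (sym eq) (here refl)) , endpoint
    where
    endpoint : ∀ {i j} → adj H i j ≡ true → i ≡ x ⊎ i ≡ y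
    endpoint ij-adj with ∈-edges⁺ H ij-adj
    ... | inj₁ ij∈ with subst (_ ∈ₗ_) eq ij∈
    ...   | here refl = inj₁ refl
    endpoint ij-adj | inj₂ ji∈ with subst (_ ∈ₗ_) eq ji∈
    ...   | here refl = inj₂ refl

-- Interval colourings

module _ {n} {G : Graph n} {c : Fin n → Fin n → ℕ} (ic : IsIntervalColouring G c) where

  open IsIntervalColouring ic

  InBand : ℕ → ℕ → ℕ → Set
  InBand lo hi x = lo ≤ x × x < hi

  inBand? : ∀ lo hi → Decidable (InBand lo hi)
  inBand? lo hi x = lo ≤? x ×-dec x <? hi

  BandEdge : ℕ → ℕ → Fin n × Fin n → Set
  BandEdge lo hi (i , j) = InBand lo hi (c i j)

  bandEdge? : ∀ lo hi → Decidable (BandEdge lo hi)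
  bandEdge? lo hi (i , j) = inBand? lo hi (c i j)

  bandEdge-sym : ∀ {lo hi i j} → adj G i j ≡ true → BandEdge lo hi (i , j) → BandEdge lo hi (j , i)
  bandEdge-sym {lo} {hi} {i} {j} ij-adj = subst (InBand lo hi) (symmetric i j ij-adj)

  HasColourIn : ℕ → ℕ → Fin n → Set
  HasColourIn lo hi v = ∃ λ w → adj G v w ≡ true × InBand lo hi (c v w)

  hasColourIn? : ∀ lo hi → Decidable (HasColourIn lo hi)
  hasColourIn? lo hi v = any? λ w → (adj G v w Bool.≟ true) ×-dec inBand? lo hi (c v w)

  bandGraph : ℕ → ℕ → Graph n
  bandGraph lo hi = restrict G (bandEdge? lo hi) bandEdge-sym

  bandVertices : ℕ → ℕ → Subset n
  bandVertices lo hi = subsetOf (hasColourIn? lo hi)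

  adj-bandGraph⁺ : ∀ {lo hi i j} → adj G i j ≡ true → InBand lo hi (c i j) → adj (bandGraph lo hi) i j ≡ true
  adj-bandGraph⁺ {lo} {hi} = adj-restrict⁺ G (bandEdge? lo hi) bandEdge-sym

  adj-bandGraph⁻ : ∀ {lo hi i j} → adj (bandGraph lo hi) i j ≡ true → adj G i j ≡ true × InBand lo hi (c i j)
  adj-bandGraph⁻ {lo} {hi} = adj-restrict⁻ G (bandEdge? lo hi) bandEdge-sym

  numEdges-bandGraph : ∀ lo hi → numEdges (bandGraph lo hi) ≡ length (filter (bandEdge? lo hi) (edges G))
  numEdges-bandGraph lo hi = cong length (edges-restrict G (bandEdge? lo hi) bandEdge-sym)

  ∈-bandVertices⁺ : ∀ {lo hi v w} → adj G v w ≡ true → InBand lo hi (c v w) → v ∈ bandVertices lo hi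
  ∈-bandVertices⁺ {lo} {hi} vw-adj inBand = ∈-subsetOf⁺ (hasColourIn? lo hi) (_ , vw-adj , inBand)

  ∈-bandVertices⁻ : ∀ {lo hi v} → v ∈ bandVertices lo hi → HasColourIn lo hi v
  ∈-bandVertices⁻ {lo} {hi} = ∈-subsetOf⁻ (hasColourIn? lo hi)

  endpoints∈bandVertices : ∀ {lo hi v w} → adj G v w ≡ true → InBand lo hi (c v w) →
                           v ∈ bandVertices lo hi × w ∈ bandVertices lo hi
  endpoints∈bandVertices {lo} {hi} {v} {w} vw-adj inBand =
    ∈-bandVertices⁺ vw-adj inBand , ∈-bandVertices⁺ (adj-sym G vw-adj) (bandEdge-sym vw-adj inBand)

  bandGraph-isSubgraph : ∀ lo hi → IsSubgraph (bandGraph lo hi) (bandVertices lo hi) G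
  bandGraph-isSubgraph lo hi i j ij-adj =
    let ij-adjG , inBand = adj-bandGraph⁻ ij-adj in ij-adjG , endpoints∈bandVertices ij-adjG inBand

  bandVertices-mono : ∀ {lo hi lo′ hi′} → lo′ ≤ lo → hi ≤ hi′ → bandVertices lo hi ⊆ bandVertices lo′ hi′
  bandVertices-mono lo′≤lo hi≤hi′ v∈ with w , vw-adj , lo≤c , c<hi ← ∈-bandVertices⁻ v∈ =
    ∈-bandVertices⁺ vw-adj (≤-trans lo′≤lo lo≤c , <-≤-trans c<hi hi≤hi′)

  numEdges-bandGraph-split : ∀ {a b d} → a ≤ b → b ≤ d →
                             numEdges (bandGraph a b) + numEdges (bandGraph b d) ≡ numEdges (bandGraph a d)
  numEdges-bandGraph-split {a} {b} {d} a≤b b≤d = begin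
    numEdges (bandGraph a b) + numEdges (bandGraph b d)
      ≡⟨ cong₂ _+_ (numEdges-bandGraph a b) (numEdges-bandGraph b d) ⟩
    length (filter (bandEdge? a b) (edges G)) + length (filter (bandEdge? b d) (edges G))
      ≡⟨ length-filter-∪ (bandEdge? a b) (bandEdge? b d) (λ (_ , x<b) (b≤x , _) → <⇒≱ x<b b≤x) (edges G) ⟩
    length (filter (bandEdge? a b ∪? bandEdge? b d) (edges G))
      ≡⟨ cong length (filter-≐ (bandEdge? a b ∪? bandEdge? b d) (bandEdge? a d) (join , split) (edges G)) ⟩
    length (filter (bandEdge? a d) (edges G))
      ≡⟨ numEdges-bandGraph a d ⟨
    numEdges (bandGraph a d) ∎
    where
    open ≡-Reasoning
    join : ∀ {x} → InBand a b x ⊎ InBand b d x → InBand a d x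
    join (inj₁ (a≤x , x<b)) = a≤x , <-≤-trans x<b b≤d
    join (inj₂ (b≤x , x<d)) = ≤-trans a≤b b≤x , x<d
    split : ∀ {x} → InBand a d x → InBand a b x ⊎ InBand b d x
    split {x} (a≤x , x<d) with x <? b
    ... | yes x<b = inj₁ (a≤x , x<b)
    ... | no x≮b  = inj₂ (≮⇒≥ x≮b , x<d)

  colourCount : ℕ → ℕ
  colourCount x = numEdges (bandGraph x (suc x))

  open PrefixCounts colourCount public

  prefixSum+numEdges-bandGraph : ∀ lo hi → lo ≤ hi → prefixSum lo + numEdges (bandGraph lo hi) ≡ prefixSum hi
  prefixSum+numEdges-bandGraph lo hi lo≤hi = begin
    prefixSum lo + numEdges (bandGraph lo hi)
      ≡⟨ cong (_+ numEdges (bandGraph lo hi)) (numEdges-bandGraph-below lo) ⟨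
    numEdges (bandGraph 0 lo) + numEdges (bandGraph lo hi)
      ≡⟨ numEdges-bandGraph-split z≤n lo≤hi ⟩
    numEdges (bandGraph 0 hi)
      ≡⟨ numEdges-bandGraph-below hi ⟩
    prefixSum hi ∎
    where
    open ≡-Reasoning
    numEdges-bandGraph-below : ∀ x → numEdges (bandGraph 0 x) ≡ prefixSum x
    numEdges-bandGraph-below zero    =
      +-cancelˡ-≡ (numEdges (bandGraph 0 0)) _ 0
        (trans (numEdges-bandGraph-split {0} {0} {0} z≤n z≤n) (sym (+-identityʳ _)))
    numEdges-bandGraph-below (suc x) = begin
      numEdges (bandGraph 0 (suc x))                   ≡⟨ numEdges-bandGraph-split z≤n (n≤1+n x) ⟨
      numEdges (bandGraph 0 x) + colourCount x         ≡⟨ cong (_+ colourCount x) (numEdges-bandGraph-below x) ⟩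
      prefixSum x + colourCount x                      ∎

  private
    InBand-singleton⁺ : ∀ {q x} → x ≡ q → InBand q (suc q) x
    InBand-singleton⁺ refl = ≤-refl , ≤-refl

    InBand-singleton⁻ : ∀ {q x} → InBand q (suc q) x → x ≡ q
    InBand-singleton⁻ (q≤x , x<1+q) = ≤-antisym (s≤s⁻¹ x<1+q) q≤x

  bandEdge-witness : ∀ lo hi → 0 < numEdges (bandGraph lo hi) →
                     ∃ λ u → ∃ λ v → adj G u v ≡ true × InBand lo hi (c u v)
  bandEdge-witness lo hi 0<e with u , v , uv-adj ← numEdges-pos {H = bandGraph lo hi} 0<e =
    u , v , adj-bandGraph⁻ {lo} {hi} uv-adj

  colour-witness : ∀ {q} → 0 < colourCount q → ∃ λ u → ∃ λ v → adj G u v ≡ true × c u v ≡ q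
  colour-witness {q} 0<e with u , v , uv-adj , inBand ← bandEdge-witness q (suc q) 0<e =
    u , v , uv-adj , InBand-singleton⁻ inBand

  soleEdgeOfColour : ∀ {q} → colourCount q ≡ 1 →
                     ∃ λ x → ∃ λ y → adj G x y ≡ true × c x y ≡ q ×
                       (∀ {v w} → adj G v w ≡ true → c v w ≡ q → v ≡ x ⊎ v ≡ y)
  soleEdgeOfColour {q} e≡1 with x , y , xy-adj , endpoint ← numEdges≡1 {H = bandGraph q (suc q)} e≡1 =
    let xy-adjG , inBand = adj-bandGraph⁻ {q} {suc q} xy-adj in
    x , y , xy-adjG , InBand-singleton⁻ inBand ,
    λ vw-adj cvw≡q → endpoint (adj-bandGraph⁺ vw-adj (InBand-singleton⁺ cvw≡q))

  3≤∣p∣-twoColours : ∀ {p : Subset n} {u v x y} → adj G u v ≡ true → adj G x y ≡ true → c u v ≢ c x y →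
                     u ∈ p → v ∈ p → x ∈ p → y ∈ p → 3 ≤ ∣ p ∣
  3≤∣p∣-twoColours {u = u} {v} {x} {y} uv-adj xy-adj cuv≢cxy u∈p v∈p x∈p y∈p with u ≟ᶠ x | u ≟ᶠ y
  ... | no u≢x  | no u≢y  = 3≤∣p∣ x∈p y∈p u∈p (adj⇒≢ G xy-adj) (u≢x ∘ sym) (u≢y ∘ sym)
  ... | yes refl | _      = 3≤∣p∣ u∈p v∈p y∈p (adj⇒≢ G uv-adj) (adj⇒≢ G xy-adj) λ { refl → cuv≢cxy refl }
  ... | no u≢x  | yes refl =
    3≤∣p∣ u∈p v∈p x∈p (adj⇒≢ G uv-adj) u≢x λ { refl → cuv≢cxy (symmetric u v uv-adj) }

  bandVertices∩⊆endpoints : ∀ {q hi x y} → (∀ {v w} → adj G v w ≡ true → c v w ≡ q → v ≡ x ⊎ v ≡ y) →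
                            bandVertices q hi ∩ bandVertices 0 (suc q) ⊆ ⁅ x ⁆ ∪ ⁅ y ⁆
  bandVertices∩⊆endpoints {q} {hi} endpoint {v} v∈ =
    let v∈S , v∈T                  = x∈p∩q⁻ (bandVertices q hi) (bandVertices 0 (suc q)) v∈
        w₁ , vw₁-adj , q≤c₁ , _    = ∈-bandVertices⁻ v∈S
        w₂ , vw₂-adj , _ , c₂<1+q  = ∈-bandVertices⁻ v∈T
        w , vw-adj , cvw≡q         = interval v (c v w₂) q (c v w₁) (s≤s⁻¹ c₂<1+q) q≤c₁
                                              (w₂ , vw₂-adj , refl) (w₁ , vw₁-adj , refl)
    in x∈p∪q⁺ (Sum.map (λ { refl → x∈⁅x⁆ v }) (λ { refl → x∈⁅x⁆ v }) (endpoint vw-adj cvw≡q))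

  numColours≤prefixSupport : ∀ {B} → (∀ {e} → e ∈ₗ edges G → c (proj₁ e) (proj₂ e) < B) →
                             numColours G c ≤ prefixSupport B
  numColours≤prefixSupport {B} c<B = length≤prefixSupport B (deduplicate-! (map colour (edges G))) used
    where
    colour : Fin n × Fin n → ℕ
    colour (i , j) = c i j
    used : ∀ {x} → x ∈ₗ deduplicate _≟_ (map colour (edges G)) → x < B × 0 < colourCount x
    used x∈ with e , e∈ , refl ← ∈-map⁻ colour (∈-deduplicate⁻ _≟_ (map colour (edges G)) x∈) =
      c<B e∈ ,
      adj⇒numEdges-pos {H = bandGraph (colour e) (suc (colour e))}
        (adj-bandGraph⁺ (∈-edges⁻ G e∈) (InBand-singleton⁺ refl))

  touched : ℕ → ℕ
  touched x = ∣ bandVertices 0 x ∣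

  sparse⇒bandGraph-bound :
    ∀ {k} → (∀ (H : Graph n) (S : Subset n) → IsSubgraph H S G → 3 ≤ ∣ S ∣ →
               ℕtoℚ (numEdges H) ≤ℚ k ℚ.* (ℕtoℚ ∣ S ∣ ℚ.- ℕtoℚ 2)) →
    ∀ lo hi → 3 ≤ ∣ bandVertices lo hi ∣ → numEdges (bandGraph lo hi) ≤[ k ]· ∣ bandVertices lo hi ∣ ∸ 2
  sparse⇒bandGraph-bound sparse lo hi 3≤∣S∣ =
    ≤[]·-∸ (≤-trans (n≤1+n 2) 3≤∣S∣)
           (sparse (bandGraph lo hi) (bandVertices lo hi) (bandGraph-isSubgraph lo hi) 3≤∣S∣)

  module _ {k : ℚ} (0≤k : 0ℚ ≤ℚ k)
           (numEdges-bandGraph-bound : ∀ lo hi → 3 ≤ ∣ bandVertices lo hi ∣ →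
                                       numEdges (bandGraph lo hi) ≤[ k ]· ∣ bandVertices lo hi ∣ ∸ 2) where

    bound-noSingletonBelow : ∀ {p} → 0 < colourCount p → (∀ {x} → x < p → colourCount x ≢ 1) →
                             2 * prefixSupport p ≤[ k ]· touched (suc p) ∸ 2
    bound-noSingletonBelow {p} 0<mp no1 with prefixSupport p in U≡ | 2*prefixSupport≤prefixSum p no1
    ... | zero  | _    = 0≤[]· 0≤k
    ... | suc s | 2U≤Σ =
      ≤[]·-mono 0≤k (≤-trans 2U≤Σ (≤-reflexive (sym (prefixSum+numEdges-bandGraph 0 (suc p) z≤n)))) ≤-refl
                (numEdges-bandGraph-bound 0 (suc p) 3≤touched)
      where
      earlier : 0 < numEdges (bandGraph 0 p)
      earlier = begin
        1                            ≤⟨ s≤s z≤n ⟩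
        suc s                        ≡⟨ U≡ ⟨
        prefixSupport p              ≤⟨ prefixSupport≤prefixSum p ⟩
        prefixSum p                  ≡⟨ prefixSum+numEdges-bandGraph 0 p z≤n ⟨
        numEdges (bandGraph 0 p)     ∎
        where open ≤-Reasoning
      3≤touched : 3 ≤ touched (suc p)
      3≤touched =
        let x , y , xy-adj , _ , cxy<p = bandEdge-witness 0 p earlier
            u , v , uv-adj , cuv≡p     = colour-witness 0<mp
            x∈ , y∈ = endpoints∈bandVertices xy-adj (z≤n , m≤n⇒m≤1+n cxy<p)
            u∈ , v∈ = endpoints∈bandVertices uv-adj (subst (InBand 0 (suc p)) (sym cuv≡p) (z≤n , ≤-refl))
        in 3≤∣p∣-twoColours xy-adj uv-adj (λ cxy≡cuv → <-irrefl (trans cxy≡cuv cuv≡p) cxy<p) x∈ y∈ u∈ v∈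

    bound-lastSingleton : ∀ {q p} → colourCount q ≡ 1 → q < p → 0 < colourCount p →
                          (∀ {x} → q < x → x < p → colourCount x ≢ 1) →
                          2 * prefixSupport q ≤[ k ]· touched (suc q) ∸ 2 →
                          2 * prefixSupport p ≤[ k ]· touched (suc p) ∸ 2
    bound-lastSingleton {q} {p} mq≡1 q<p 0<mp no1 ih
      with x , y , xy-adj , cxy≡q , endpoint ← soleEdgeOfColour mq≡1
         | u , v , uv-adj , cuv≡p ← colour-witness 0<mp
      = ≤[]·-mono 0≤k colours vertices (+-mono-≤[]· 0≤k ih (numEdges-bandGraph-bound q (suc p) 3≤∣window∣))
      where
      window before after : Subset n
      window = bandVertices q (suc p)
      before = bandVertices 0 (suc q)
      after  = bandVertices 0 (suc p)
      e : ℕ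
      e = numEdges (bandGraph q (suc p))
      q≤p : q ≤ p
      q≤p = <⇒≤ q<p

      3≤∣window∣ : 3 ≤ ∣ window ∣
      3≤∣window∣ =
        let x∈ , y∈ = endpoints∈bandVertices xy-adj (subst (InBand q (suc p)) (sym cxy≡q) (≤-refl , s≤s q≤p))
            u∈ , v∈ = endpoints∈bandVertices uv-adj (subst (InBand q (suc p)) (sym cuv≡p) (q≤p , ≤-refl))
            cxy≢cuv = λ cxy≡cuv → <-irrefl (trans (sym cxy≡q) (trans cxy≡cuv cuv≡p)) q<p
        in 3≤∣p∣-twoColours xy-adj uv-adj cxy≢cuv x∈ y∈ u∈ v∈

      colours : 2 * prefixSupport p ≤ 2 * prefixSupport q + e
      colours = +-cancelʳ-≤ (prefixSum q) _ _ (begin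
        2 * prefixSupport p + prefixSum q       ≤⟨ 2*prefixSupport-window mq≡1 q<p 0<mp no1 ⟩
        2 * prefixSupport q + prefixSum (suc p) ≡⟨ cong (_+_ (2 * prefixSupport q))
                                                        (prefixSum+numEdges-bandGraph q (suc p) (m≤n⇒m≤1+n q≤p)) ⟨
        2 * prefixSupport q + (prefixSum q + e) ≡⟨ cong (_+_ (2 * prefixSupport q)) (+-comm (prefixSum q) e) ⟩
        2 * prefixSupport q + (e + prefixSum q) ≡⟨ +-assoc (2 * prefixSupport q) e (prefixSum q) ⟨
        2 * prefixSupport q + e + prefixSum q   ∎)
        where open ≤-Reasoning

      vertices : (∣ before ∣ ∸ 2) + (∣ window ∣ ∸ 2) ≤ ∣ after ∣ ∸ 2
      vertices =
        let x∈ , y∈ = endpoints∈bandVertices xy-adj (subst (InBand 0 (suc q)) (sym cxy≡q) (z≤n , ≤-refl))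
        in ∸2+∸2≤∸2 (2≤∣p∣ x∈ y∈ (adj⇒≢ G xy-adj)) (≤-trans (n≤1+n 2) 3≤∣window∣) (begin
          ∣ before ∣ + ∣ window ∣                      ≡⟨ +-comm ∣ before ∣ ∣ window ∣ ⟩
          ∣ window ∣ + ∣ before ∣                      ≡⟨ ∣p∪q∣+∣p∩q∣≡∣p∣+∣q∣ window before ⟨
          ∣ window ∪ before ∣ + ∣ window ∩ before ∣    ≤⟨ +-mono-≤ (p⊆q⇒∣p∣≤∣q∣ window∪before⊆after)
                                                                  (p⊆q⇒∣p∣≤∣q∣ (bandVertices∩⊆endpoints endpoint)) ⟩
          ∣ after ∣ + ∣ ⁅ x ⁆ ∪ ⁅ y ⁆ ∣                ≤⟨ +-monoʳ-≤ ∣ after ∣ (∣p∪q∣≤∣p∣+∣q∣ ⁅ x ⁆ ⁅ y ⁆) ⟩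
          ∣ after ∣ + (∣ ⁅ x ⁆ ∣ + ∣ ⁅ y ⁆ ∣)          ≡⟨ cong₂ (λ a b → ∣ after ∣ + (a + b)) (∣⁅x⁆∣≡1 x) (∣⁅x⁆∣≡1 y) ⟩
          ∣ after ∣ + 2                               ∎)
        where
        open ≤-Reasoning
        window∪before⊆after : window ∪ before ⊆ after
        window∪before⊆after v∈ = [ bandVertices-mono z≤n ≤-refl , bandVertices-mono ≤-refl (s≤s q≤p) ]
                                   (x∈p∪q⁻ window before v∈)

    usedColours-bound : ∀ x → 2 * (prefixSupport x ∸ 1) ≤[ k ]· touched x ∸ 2
    usedColours-bound = <-rec _ step
      where
      step : ∀ x → (∀ {y} → y < x → 2 * (prefixSupport y ∸ 1) ≤[ k ]· touched y ∸ 2) →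
             2 * (prefixSupport x ∸ 1) ≤[ k ]· touched x ∸ 2
      step zero    _   = 0≤[]· 0≤k
      step (suc p) rec with colourCount p in mp≡ | lastBelow (λ x → colourCount x ≟ 1) p
      ... | zero  | _ =
        ≤[]·-mono 0≤k ≤-refl (∸-monoˡ-≤ 2 (p⊆q⇒∣p∣≤∣q∣ (bandVertices-mono ≤-refl (n≤1+n p)))) (rec ≤-refl)
      ... | suc _ | inj₁ none = bound-noSingletonBelow 0<mp none
        where 0<mp = subst (0 <_) (sym mp≡) (s≤s z≤n)
      ... | suc _ | inj₂ (q , q<p , mq≡1 , none) = bound-lastSingleton mq≡1 q<p 0<mp none ih
        where
        0<mp = subst (0 <_) (sym mp≡) (s≤s z≤n)
        ih = subst (λ s → 2 * (s ∸ 1) ≤[ k ]· touched (suc q) ∸ 2)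
                   (prefixSupport-suc q (≤-reflexive (sym mq≡1))) (rec (s≤s q<p))

theorem9 : (k : ℚ) → 0ℚ ≤ℚ k →
           (n : ℕ) → 2 ≤ n → (G : Graph n) →
           (∀ (H : Graph n) (S : Subset n) → IsSubgraph H S G → 3 ≤ ∣ S ∣ →
             ℕtoℚ (numEdges H) ≤ℚ k ℚ.* (ℕtoℚ ∣ S ∣ ℚ.- ℕtoℚ 2)) →
           (c : Fin n → Fin n → ℕ) → IsIntervalColouring G c →
           ℕtoℚ (numColours G c) ≤ℚ ((½ ℚ.* k) ℚ.* ℕtoℚ n ℚ.+ 1ℚ) ℚ.- k
theorem9 k 0≤k n 2≤n G sparse c ic =
  ≤½kn+1-k 0≤k {numColours G c} 2≤n (≤[]·-mono 0≤k t∸1≤U∸1 touched≤n bound)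
  where
  colour : Fin n × Fin n → ℕ
  colour (i , j) = c i j
  B : ℕ
  B = suc (max 0 (map colour (edges G)))
  colour<B : ∀ {e} → e ∈ₗ edges G → colour e < B
  colour<B e∈ = s≤s (All.lookup (xs≤max 0 (map colour (edges G))) (∈-map⁺ colour e∈))
  bound : 2 * (prefixSupport ic B ∸ 1) ≤[ k ]· touched ic B ∸ 2
  bound = usedColours-bound ic 0≤k (sparse⇒bandGraph-bound ic sparse) B
  t∸1≤U∸1 : 2 * (numColours G c ∸ 1) ≤ 2 * (prefixSupport ic B ∸ 1)
  t∸1≤U∸1 = *-monoʳ-≤ 2 (∸-monoˡ-≤ 1 (numColours≤prefixSupport ic colour<B))
  touched≤n : touched ic B ∸ 2 ≤ n ∸ 2
  touched≤n = ∸-monoˡ-≤ 2 (∣p∣≤n (bandVertices ic 0 B))
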